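{- Let $\mathbf{A}$ be a Heyting algebra, $\nabla$ a filter of $\mathbf{A}$ containing all dense elements, and $\Delta$ an ideal of $\mathbf{A}$. The twist-structure $Tw(\mathbf{A},\nabla,\Delta)$ can be represented (up to isomorphism) as the algebra of open pairs $\mathcal{G}_2(\mathbf{T})$ of some twist-structure $\mathbf{T}=Tw(\mathbf{B},\nabla',\Delta')$ over a topological Boolean algebra $\mathbf{B}$ (with $\nabla'$ an open filter, $\Delta'$ a closed ideal of $\mathbf{B}$, and $\Gamma(\mathbf{T})=\Lambda(\mathbf{B},\nabla')$) if and only if $\Delta$ is closed, i.e. $\neg\neg a\in\Delta$ for all $a\in\Delta$.
   Context: In a Heyting algebra $\neg a:=a\to\bot$; $a$ is dense if $\neg a=\bot$. A topological Boolean algebra (TBA) is an algebra $\langle B;\vee,\wedge,\to,\bot,\Box\rangle$ whose reduct is a Boolean algebra with $\Box 1=1$, $\Box(a\wedge b)=\Box a\wedge\Box b$, $\Box a\le a$, $\Box a\le\Box\Box a$; $\Diamond a:=\neg\Box\neg a$. $\mathsf{G}(\mathbf{B})=\{a:\Box a=a\}$; $\mathcal{G}(\mathbf{B})$ is the Heyting algebra on it with $\vee,\wedge,\bot$ of $\mathbf{B}$ and $a\to_{\mathcal{G}}b=\Box(a\to b)$. A filter is open if closed under $\Box$, an ideal closed (in a TBA) if closed under $\Diamond$. Full twist-structure $\mathbf{C}^{\bowtie}$: universe $C\times C$, $(a,b)\vee(c,d)=(a\vee c,b\wedge d)$, $(a,b)\wedge(c,d)=(a\wedge c,b\vee d)$,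 $(a,b)\to(c,d)=(a\to c,a\wedge d)$, $\bot=(\bot,1)$, $\sim(a,b)=(b,a)$, and for a TBA also $\Box(a,b)=(\Box a,\Diamond b)$, $\Diamond(a,b)=(\Diamond a,\Box b)$. $Tw(\mathbf{C},\nabla,\Delta)$ is the subalgebra of $\mathbf{C}^{\bowtie}$ on $\{(a,b):a\vee b\in\nabla,\ a\wedge b\in\Delta\}$. For $\mathbf{T}=Tw(\mathbf{B},\nabla',\Delta')$: $\mathsf{G}_2(\mathbf{T})=\{(a,b)\in\mathbf{T}:\Box a=a,\Box b=b\}$, $\Gamma(\mathbf{T})=\pi_1(\mathsf{G}_2(\mathbf{T}))$, $\Lambda(\mathbf{B},\nabla')=\{a\in\mathsf{G}(\mathbf{B}):a\vee\Box\neg a\in\nabla'\}$; when $\Gamma(\mathbf{T})=\Lambda(\mathbf{B},\nabla')$, the algebra of open pairs $\mathcal{G}_2(\mathbf{T})$ is $\mathsf{G}_2(\mathbf{T})$ with the operations $\vee,\wedge,\to,\bot,\sim$ of $\mathcal{G}(\mathbf{B})^{\bowtie}$; it is a twist-structure over a Heyting subalgebra of $\mathcal{G}(\mathbf{B})$. -}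

module Defs where

open import Level using (Level; _⊔_; suc; Setω)
open import Data.Product using (_×_; _,_; proj₁; proj₂; Σ; ∃)
open import Relation.Unary using (Pred; _∈_)
open import Relation.Binary using (Rel)
open import Algebra.Core using (Op₁; Op₂)
import Relation.Binary.Lattice.Bundles as RL
import Algebra.Lattice.Bundles as AL

module HA {c ℓ₁ ℓ₂ : Level} (A : RL.HeytingAlgebra c ℓ₁ ℓ₂) where
  open RL.HeytingAlgebra A

  ¬ₕ : Carrier → Carrier
  ¬ₕ a = a ⇨ ⊥

  Dense : Carrier → Set ℓ₁
  Dense a = ¬ₕ a ≈ ⊥

  record IsFilter {p} (F : Pred Carrier p) : Set (c ⊔ ℓ₂ ⊔ p) where
    field
      ⊤∈    : ⊤ ∈ F
      ∧-closed : ∀ {a b} → a ∈ F → b ∈ F → (a ∧ b) ∈ F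
      up    : ∀ {a b} → a ≤ b → a ∈ F → b ∈ F

  record IsIdeal {p} (I : Pred Carrier p) : Set (c ⊔ ℓ₂ ⊔ p) where
    field
      ⊥∈    : ⊥ ∈ I
      ∨-closed : ∀ {a b} → a ∈ I → b ∈ I → (a ∨ b) ∈ I
      down  : ∀ {a b} → b ≤ a → a ∈ I → b ∈ I

  ClosedIdeal : ∀ {p} → Pred Carrier p → Set (c ⊔ p)
  ClosedIdeal Δ = ∀ {a} → a ∈ Δ → ¬ₕ (¬ₕ a) ∈ Δ

record TBA (c ℓ : Level) : Set (suc (c ⊔ ℓ)) where
  field
    boolean : AL.BooleanAlgebra c ℓ
  open AL.BooleanAlgebra boolean public
  infixr 5 _⇒_
  _⇒_ : Op₂ Carrier
  a ⇒ b = (¬ a) ∨ b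
  _≤_ : Rel Carrier ℓ
  a ≤ b = (a ∧ b) ≈ a
  field
    □       : Op₁ Carrier
    □-cong  : ∀ {a b} → a ≈ b → □ a ≈ □ b
    □-⊤     : □ ⊤ ≈ ⊤
    □-∧     : ∀ a b → □ (a ∧ b) ≈ (□ a ∧ □ b)
    □-deflationary : ∀ a → □ a ≤ a
    □-4     : ∀ a → □ a ≤ □ (□ a)
  ◇ : Op₁ Carrier
  ◇ a = ¬ (□ (¬ a))

  record IsFilter {p} (F : Pred Carrier p) : Set (c ⊔ ℓ ⊔ p) where
    field
      ⊤∈    : ⊤ ∈ F
      ∧-closed : ∀ {a b} → a ∈ F → b ∈ F → (a ∧ b) ∈ F
      up    : ∀ {a b} → a ≤ b → a ∈ F → b ∈ F

  record IsIdeal {p} (I : Pred Carrier p) : Set (c ⊔ ℓ ⊔ p) where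
    field
      ⊥∈    : ⊥ ∈ I
      ∨-closed : ∀ {a b} → a ∈ I → b ∈ I → (a ∨ b) ∈ I
      down  : ∀ {a b} → b ≤ a → a ∈ I → b ∈ I

  record IsOpenFilter {p} (F : Pred Carrier p) : Set (c ⊔ ℓ ⊔ p) where
    field
      isFilter : IsFilter F
      □-closed : ∀ {a} → a ∈ F → □ a ∈ F

  record IsClosedIdeal {p} (I : Pred Carrier p) : Set (c ⊔ ℓ ⊔ p) where
    field
      isIdeal  : IsIdeal I
      ◇-closed : ∀ {a} → a ∈ I → ◇ a ∈ I

  Open : Pred Carrier ℓ
  Open a = □ a ≈ a

  module Twist {p} (∇′ Δ′ : Pred Carrier p) where
    T : Pred (Carrier × Carrier) p
    T (a , b) = ((a ∨ b) ∈ ∇′) × ((a ∧ b) ∈ Δ′)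

    G₂ : Pred (Carrier × Carrier) (ℓ ⊔ p)
    G₂ (a , b) = T (a , b) × Open a × Open b

    Γ : Pred Carrier (c ⊔ ℓ ⊔ p)
    Γ a = Σ Carrier λ b → G₂ (a , b)

    Λ : Pred Carrier (ℓ ⊔ p)
    Λ a = Open a × ((a ∨ □ (¬ a)) ∈ ∇′)

-- Algebras of pairs in the signature ⟨∨, ∧, →, ⊥, ∼⟩, given as a
-- subset U of C × C closed under the operations of a full twist-structure.

record PairAlg (c ℓ p : Level) : Set (suc (c ⊔ ℓ ⊔ p)) where
  field
    C     : Set c
    _≈C_  : Rel C ℓ
    U     : Pred (C × C) p
    _∨ᵗ_  : Op₂ (C × C)
    _∧ᵗ_  : Op₂ (C × C)
    _→ᵗ_  : Op₂ (C × C)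
    ⊥ᵗ    : C × C
    ∼ᵗ    : Op₁ (C × C)
  _≈_ : Rel (C × C) ℓ
  (a , b) ≈ (a′ , b′) = (a ≈C a′) × (b ≈C b′)

TwHA : ∀ {c ℓ₁ ℓ₂ p} (A : RL.HeytingAlgebra c ℓ₁ ℓ₂) (∇ Δ : Pred (RL.HeytingAlgebra.Carrier A) p) →
       PairAlg c ℓ₁ p
TwHA A ∇ Δ = record
  { C = Carrier ; _≈C_ = _≈_
  ; U = λ { (a , b) → ((a ∨ b) ∈ ∇) × ((a ∧ b) ∈ Δ) }
  ; _∨ᵗ_ = λ { (a , b) (c , d) → (a ∨ c , b ∧ d) }
  ; _∧ᵗ_ = λ { (a , b) (c , d) → (a ∧ c , b ∨ d) }
  ; _→ᵗ_ = λ { (a , b) (c , d) → (a ⇨ c , a ∧ d) }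
  ; ⊥ᵗ = (⊥ , ⊤)
  ; ∼ᵗ = λ { (a , b) → (b , a) } }
  where open RL.HeytingAlgebra A

-- The algebra of open pairs 𝒢₂(T) of T = Tw(B, ∇′, Δ′): the set G₂(T)
-- with the operations of 𝒢(B)^⋈ (implication a →𝒢 b = □(a → b)).
G₂Alg : ∀ {c ℓ p} (B : TBA c ℓ) (∇′ Δ′ : Pred (TBA.Carrier B) p) → PairAlg c ℓ (ℓ ⊔ p)
G₂Alg B ∇′ Δ′ = record
  { C = Carrier ; _≈C_ = _≈_
  ; U = Twist.G₂ ∇′ Δ′
  ; _∨ᵗ_ = λ { (a , b) (c , d) → (a ∨ c , b ∧ d) }
  ; _∧ᵗ_ = λ { (a , b) (c , d) → (a ∧ c , b ∨ d) }
  ; _→ᵗ_ = λ { (a , b) (c , d) → (□ (a ⇒ c) , a ∧ d) }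
  ; ⊥ᵗ = (⊥ , ⊤)
  ; ∼ᵗ = λ { (a , b) → (b , a) } }
  where open TBA B

record Iso {c₁ ℓ₁ p₁ c₂ ℓ₂ p₂} (X : PairAlg c₁ ℓ₁ p₁) (Y : PairAlg c₂ ℓ₂ p₂)
       : Set (c₁ ⊔ ℓ₁ ⊔ p₁ ⊔ c₂ ⊔ ℓ₂ ⊔ p₂) where
  module X = PairAlg X
  module Y = PairAlg Y
  field
    f        : X.C × X.C → Y.C × Y.C
    f-U      : ∀ {x} → x ∈ X.U → f x ∈ Y.U
    f-cong   : ∀ {x y} → x ∈ X.U → y ∈ X.U → x X.≈ y → f x Y.≈ f y
    f-inj    : ∀ {x y} → x ∈ X.U → y ∈ X.U → f x Y.≈ f y → x X.≈ y
    f-surj   : ∀ {y} → y ∈ Y.U → Σ (X.C × X.C) λ x → (x ∈ X.U) × (f x Y.≈ y)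
    f-∨      : ∀ {x y} → x ∈ X.U → y ∈ X.U → f (x X.∨ᵗ y) Y.≈ (f x Y.∨ᵗ f y)
    f-∧      : ∀ {x y} → x ∈ X.U → y ∈ X.U → f (x X.∧ᵗ y) Y.≈ (f x Y.∧ᵗ f y)
    f-→      : ∀ {x y} → x ∈ X.U → y ∈ X.U → f (x X.→ᵗ y) Y.≈ (f x Y.→ᵗ f y)
    f-⊥      : f X.⊥ᵗ Y.≈ Y.⊥ᵗ
    f-∼      : ∀ {x} → x ∈ X.U → f (X.∼ᵗ x) Y.≈ Y.∼ᵗ (f x)

-- "Tw(A,∇,Δ) is isomorphic to 𝒢₂(T) for some T = Tw(B,∇′,Δ′) over a TBA B,
--  with ∇′ an open filter, Δ′ a closed ideal, and Γ(T) = Λ(B,∇′)."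
-- B may live in any universe, hence this lives in Setω.

record OpenPairRep {c ℓ₁ ℓ₂ p} (A : RL.HeytingAlgebra c ℓ₁ ℓ₂)
       (∇ Δ : Pred (RL.HeytingAlgebra.Carrier A) p) : Setω where
  field
    cB ℓB pB : Level
    B   : TBA cB ℓB
    ∇′  : Pred (TBA.Carrier B) pB
    Δ′  : Pred (TBA.Carrier B) pB
    ∇′-open   : TBA.IsOpenFilter B ∇′
    Δ′-closed : TBA.IsClosedIdeal B Δ′
    Γ⊆Λ : ∀ {a} → TBA.Twist.Γ B ∇′ Δ′ a → TBA.Twist.Λ B ∇′ Δ′ a
    Λ⊆Γ : ∀ {a} → TBA.Twist.Λ B ∇′ Δ′ a → TBA.Twist.Γ B ∇′ Δ′ a
    iso : Iso (TwHA A ∇ Δ) (G₂Alg B ∇′ Δ′)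

record _⇔ω_ {ℓ} (P : Setω) (Q : Set ℓ) : Setω where
  field
    to   : P → Q
    from : Q → P

-- A Heyting algebra A is the algebra of open elements of its Boolean
-- extension, realised as finite conjunctions of formal implications a ⇒ b
-- (a, b ∈ A) with interior □ ⋀ (aᵢ ⇒ bᵢ) = ⋀ (aᵢ → bᵢ).  If Δ is closed, let
-- ∇′ be the filter generated by ∇ and Δ′ the ◇-closed ideal generated by Δ;
-- the embedding a ↦ a then maps Tw(A, ∇, Δ) isomorphically onto 𝒢₂(T), and
-- surjectivity needs exactly that □◇d = ¬¬d lies in Δ for d ∈ Δ.
-- Conversely, in any such representation f the twist operations detect
-- whether a first coordinate is ⊤ (x → ⊥ = ⊥ iff x₁ = ⊤), so f preserves and
-- reflects this.  For a ∈ Δ, f(a, ⊤) = (p, ⊤) with p ∈ Δ′, so (□◇p, ⊤) lies in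
-- 𝒢₂(T); as □◇p is the first coordinate of f(¬¬(a, ⊤)), its preimage
-- (z₁, z₂) has z₂ = ⊤ and ¬¬a → z₁ = ⊤, whence ¬¬a ≤ z₁ ∧ z₂ ∈ Δ.

module Submission where

open import Level using (_⊔_)
open import Data.Product using (_×_; _,_; proj₁; proj₂; Σ)
open import Data.Sum using (inj₁; inj₂; [_,_]′)
open import Data.List using (List; []; _∷_; _++_; map)
open import Data.List.Membership.Propositional using (_∈_)
open import Data.List.Membership.Propositional.Properties
  using (∈-map⁺; ∈-map⁻; ∈-++⁺ˡ; ∈-++⁺ʳ; ∈-++⁻)
open import Data.List.Relation.Unary.Any using (here; there)
open import Relation.Binary.PropositionalEquality using (_≡_; refl)
open import Relation.Unary using (Pred)
open import Relation.Binary.Lattice.Bundles using (HeytingAlgebra)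
open import Algebra.Lattice.Bundles using (BooleanAlgebra)
import Relation.Binary.Lattice.Properties.HeytingAlgebra as HeytingProperties
import Relation.Binary.Lattice.Properties.MeetSemilattice as MeetProperties
import Relation.Binary.Lattice.Properties.JoinSemilattice as JoinProperties
import Algebra.Lattice.Properties.BooleanAlgebra as BooleanProperties
import Relation.Binary.Lattice.Bundles as OrderLattice
import Relation.Binary.Lattice.Properties.Lattice as OrderLatticeProperties
import Relation.Binary.Lattice.Properties.DistributiveLattice as DistributiveLatticeProperties
import Relation.Binary.Reasoning.Setoid as SetoidReasoning
open import Defs

module HeytingLattice {α ℓ₁ ℓ₂} (A : HeytingAlgebra α ℓ₁ ℓ₂) where
  open HeytingAlgebra A public renaming (refl to ≤-refl)
  open HeytingProperties A public using (⇨-eval; ∧-distribˡ-∨-≤; de-morgan₁)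
  open MeetProperties meetSemilattice public using (∧-monotonic; ∧-comm)
  open JoinProperties joinSemilattice public using (∨-monotonic)

  infixr 5 _⨾_
  _⨾_ : ∀ {x y z} → x ≤ y → y ≤ z → x ≤ z
  _⨾_ = trans

  ∧-comm-≤ : ∀ {x y} → x ∧ y ≤ y ∧ x
  ∧-comm-≤ = reflexive (∧-comm _ _)

  ∧-distribʳ-∨-≤ : ∀ {x y z} → (y ∨ z) ∧ x ≤ (y ∧ x) ∨ (z ∧ x)
  ∧-distribʳ-∨-≤ = ∧-comm-≤ ⨾ ∧-distribˡ-∨-≤ _ _ _ ⨾ ∨-monotonic ∧-comm-≤ ∧-comm-≤

  [x∨y]∧z≤x∨[z∧y] : ∀ {x y z} → (x ∨ y) ∧ z ≤ x ∨ (z ∧ y)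
  [x∨y]∧z≤x∨[z∧y] = ∧-distribʳ-∨-≤ ⨾ ∨-monotonic (x∧y≤x _ _) ∧-comm-≤

  ∨-distribʳ-∧-≥ : ∀ {x y z} → (x ∨ z) ∧ (y ∨ z) ≤ (x ∧ y) ∨ z
  ∨-distribʳ-∧-≥ =
    ∧-distribʳ-∨-≤ ⨾ ∨-least (∧-distribˡ-∨-≤ _ _ _ ⨾ ∨-monotonic ≤-refl (x∧y≤y _ _))
                             (x∧y≤x _ _ ⨾ y≤x∨y _ _)

  [x∧y]∧z≤[x∧z]∧y : ∀ {x y z} → (x ∧ y) ∧ z ≤ (x ∧ z) ∧ y
  [x∧y]∧z≤[x∧z]∧y = ∧-greatest (∧-monotonic (x∧y≤x _ _) ≤-refl) (x∧y≤x _ _ ⨾ x∧y≤y _ _)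

  ⊤≤⇨⇒≤ : ∀ {x y} → ⊤ ≤ x ⇨ y → x ≤ y
  ⊤≤⇨⇒≤ h = ∧-greatest (maximum _ ⨾ h) ≤-refl ⨾ ⇨-eval

  ∨-dense : ∀ {x y} → (x ⇨ ⊥) ∧ (y ⇨ ⊥) ≤ ⊥ → HA.Dense A (x ∨ y)
  ∨-dense {x} {y} h = antisym (reflexive (de-morgan₁ x y) ⨾ h) (minimum _)

module BooleanExtension {α ℓ₁ ℓ₂} (A : HeytingAlgebra α ℓ₁ ℓ₂) where
  open HeytingLattice A

  Clause : Set α
  Clause = Carrier × Carrier

  -- A list of clauses (a , b) denotes the conjunction of the Boolean
  -- implications a ⇒ b; X ⊢ c ≤ d says X ∧ c ≤ d, computed by splitting
  -- on the first clause.
  infix 4 _⊢_≤_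
  _⊢_≤_ : List Clause → Carrier → Carrier → Set ℓ₂
  [] ⊢ c ≤ d = c ≤ d
  ((a , b) ∷ X) ⊢ c ≤ d = (X ⊢ c ≤ d ∨ a) × (X ⊢ c ∧ b ≤ d)

  ⊢-mono : ∀ X {c c′ d d′} → c′ ≤ c → d ≤ d′ → X ⊢ c ≤ d → X ⊢ c′ ≤ d′
  ⊢-mono [] p q r = p ⨾ r ⨾ q
  ⊢-mono ((a , b) ∷ X) p q (r , s) =
    ⊢-mono X p (∨-monotonic q ≤-refl) r , ⊢-mono X (∧-monotonic p ≤-refl) q s

  ≤⇒⊢ : ∀ X {c d} → c ≤ d → X ⊢ c ≤ d
  ≤⇒⊢ [] p = p
  ≤⇒⊢ ((a , b) ∷ X) p = ≤⇒⊢ X (p ⨾ x≤x∨y _ _) , ≤⇒⊢ X (x∧y≤x _ _ ⨾ p)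

  ⊢-∨-least : ∀ X {c₁ c₂ d} → X ⊢ c₁ ≤ d → X ⊢ c₂ ≤ d → X ⊢ c₁ ∨ c₂ ≤ d
  ⊢-∨-least [] p q = ∨-least p q
  ⊢-∨-least ((a , b) ∷ X) (p , p′) (q , q′) =
    ⊢-∨-least X p q , ⊢-mono X ∧-distribʳ-∨-≤ ≤-refl (⊢-∨-least X p′ q′)

  ⊢-∧-greatest : ∀ X {c d₁ d₂} → X ⊢ c ≤ d₁ → X ⊢ c ≤ d₂ → X ⊢ c ≤ d₁ ∧ d₂
  ⊢-∧-greatest [] p q = ∧-greatest p q
  ⊢-∧-greatest ((a , b) ∷ X) (p , p′) (q , q′) =
    ⊢-mono X ≤-refl ∨-distribʳ-∧-≥ (⊢-∧-greatest X p q) , ⊢-∧-greatest X p′ q′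

  ⊢-trans : ∀ X {c e d} → X ⊢ c ≤ e → X ⊢ e ≤ d → X ⊢ c ≤ d
  ⊢-trans [] p q = p ⨾ q
  ⊢-trans ((a , b) ∷ X) (p , p′) (q , q′) =
    ⊢-trans X p (⊢-∨-least X q (≤⇒⊢ X (y≤x∨y _ _))) ,
    ⊢-trans X (⊢-∧-greatest X p′ (≤⇒⊢ X (x∧y≤y _ _))) q′

  ⊢-cut : ∀ X {c d a} → X ⊢ c ≤ d ∨ a → X ⊢ c ∧ a ≤ d → X ⊢ c ≤ d
  ⊢-cut X p q =
    ⊢-trans X (⊢-mono X ≤-refl [x∨y]∧z≤x∨[z∧y] (⊢-∧-greatest X p (≤⇒⊢ X ≤-refl)))
              (⊢-∨-least X (≤⇒⊢ X ≤-refl) q)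

  ⊢-clause : ∀ X {a b c d} → (a , b) ∈ X → c ≤ d ∨ a → c ∧ b ≤ d → X ⊢ c ≤ d
  ⊢-clause ((a , b) ∷ X) (here refl) p q = ≤⇒⊢ X p , ≤⇒⊢ X q
  ⊢-clause (_ ∷ X) (there m) p q =
    ⊢-clause X m (p ⨾ ∨-monotonic (x≤x∨y _ _) ≤-refl) (q ⨾ x≤x∨y _ _) ,
    ⊢-clause X m (x∧y≤x _ _ ⨾ p) (∧-monotonic (x∧y≤x _ _) ≤-refl ⨾ q)

  ⊢-apply : ∀ X {a b c d} → (a , b) ∈ X → c ≤ a → b ≤ d → X ⊢ c ≤ d
  ⊢-apply X m p q = ⊢-clause X m (p ⨾ y≤x∨y _ _) (x∧y≤y _ _ ⨾ q)

  ⊢-weaken : ∀ X Y {c d} → Y ⊢ c ≤ d → X ++ Y ⊢ c ≤ d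
  ⊢-weaken [] Y p = p
  ⊢-weaken ((a , b) ∷ X) Y p =
    ⊢-weaken X Y (⊢-mono Y ≤-refl (x≤x∨y _ _) p) , ⊢-weaken X Y (⊢-mono Y (x∧y≤x _ _) ≤-refl p)

  -- X entails every clause of Y; a record, so that X and Y can be inferred.
  infix 4 _⊑_ _≃_
  record _⊑_ (X Y : List Clause) : Set (α ⊔ ℓ₂) where
    constructor ⊑-intro
    field ⊑-elim : ∀ {c d} → (c , d) ∈ Y → X ⊢ c ≤ d
  open _⊑_ public

  _≃_ : List Clause → List Clause → Set (α ⊔ ℓ₂)
  X ≃ Y = X ⊑ Y × Y ⊑ X

  ⊑-tail : ∀ {X y Y} → X ⊑ y ∷ Y → X ⊑ Y
  ⊑-tail p = ⊑-intro λ m → ⊑-elim p (there m)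

  ⊇⇒⊑ : ∀ {X Y} → (∀ {u} → u ∈ Y → u ∈ X) → X ⊑ Y
  ⊇⇒⊑ {X} sub = ⊑-intro λ m → ⊢-apply X (sub m) ≤-refl ≤-refl

  ⊑-refl : ∀ {X} → X ⊑ X
  ⊑-refl = ⊇⇒⊑ λ m → m

  ⊢-⊑ : ∀ {X Y c d} → X ⊑ Y → Y ⊢ c ≤ d → X ⊢ c ≤ d
  ⊢-⊑ {X} {[]} _ p = ≤⇒⊢ X p
  ⊢-⊑ {X} {_ ∷ Y} X⊑y∷Y (p , q) =
    ⊢-cut X (⊢-⊑ (⊑-tail X⊑y∷Y) p)
      (⊢-trans X (⊢-∧-greatest X (≤⇒⊢ X (x∧y≤x _ _))
                                 (⊢-trans X (≤⇒⊢ X (x∧y≤y _ _)) (⊑-elim X⊑y∷Y (here refl))))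
                 (⊢-⊑ (⊑-tail X⊑y∷Y) q))

  ⊑-trans : ∀ {X Y Z} → X ⊑ Y → Y ⊑ Z → X ⊑ Z
  ⊑-trans p q = ⊑-intro λ m → ⊢-⊑ p (⊑-elim q m)

  ≃-refl : ∀ {X} → X ≃ X
  ≃-refl = ⊑-refl , ⊑-refl

  ≃-sym : ∀ {X Y} → X ≃ Y → Y ≃ X
  ≃-sym (p , q) = q , p

  ≃-trans : ∀ {X Y Z} → X ≃ Y → Y ≃ Z → X ≃ Z
  ≃-trans (p , q) (p′ , q′) = ⊑-trans p p′ , ⊑-trans q′ q

  X++Y⊑X : ∀ X Y → X ++ Y ⊑ X
  X++Y⊑X X Y = ⊇⇒⊑ ∈-++⁺ˡ

  X++Y⊑Y : ∀ X Y → X ++ Y ⊑ Y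
  X++Y⊑Y X Y = ⊇⇒⊑ (∈-++⁺ʳ X)

  ++-greatest : ∀ {Z X Y} → Z ⊑ X → Z ⊑ Y → Z ⊑ X ++ Y
  ++-greatest {X = X} p q = ⊑-intro λ m → [ ⊑-elim p , ⊑-elim q ]′ (∈-++⁻ X m)

  _∨ᶜ_ : Clause → Clause → Clause
  (a , b) ∨ᶜ (a′ , b′) = (a ∧ a′ , b ∨ b′)

  infixr 6 _⊔ᴮ_
  _⊔ᴮ_ : List Clause → List Clause → List Clause
  [] ⊔ᴮ Y = []
  (x ∷ X) ⊔ᴮ Y = map (x ∨ᶜ_) Y ++ X ⊔ᴮ Y

  ∈-⊔ᴮ⁺ : ∀ X Y {x y} → x ∈ X → y ∈ Y → x ∨ᶜ y ∈ X ⊔ᴮ Y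
  ∈-⊔ᴮ⁺ (x ∷ X) Y (here refl) n = ∈-++⁺ˡ (∈-map⁺ (x ∨ᶜ_) n)
  ∈-⊔ᴮ⁺ (x ∷ X) Y (there m) n = ∈-++⁺ʳ (map (x ∨ᶜ_) Y) (∈-⊔ᴮ⁺ X Y m n)

  ∈-⊔ᴮ⁻ : ∀ X Y {u} → u ∈ X ⊔ᴮ Y → Σ Clause λ x → Σ Clause λ y → x ∈ X × y ∈ Y × u ≡ x ∨ᶜ y
  ∈-⊔ᴮ⁻ (x ∷ X) Y m with ∈-++⁻ (map (x ∨ᶜ_) Y) m
  ... | inj₁ m′ with ∈-map⁻ (x ∨ᶜ_) m′
  ...   | y , n , eq = x , y , here refl , n , eq
  ∈-⊔ᴮ⁻ (x ∷ X) Y m | inj₂ m′ with ∈-⊔ᴮ⁻ X Y m′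
  ...   | x′ , y , n₁ , n₂ , eq = x′ , y , there n₁ , n₂ , eq

  ⊔ᴮ-intro : ∀ {W} X Y → (∀ {a b a′ b′} → (a , b) ∈ X → (a′ , b′) ∈ Y → W ⊢ a ∧ a′ ≤ b ∨ b′) →
             W ⊑ X ⊔ᴮ Y
  ⊔ᴮ-intro {W} X Y f = ⊑-intro λ m → case (∈-⊔ᴮ⁻ X Y m)
    where
    case : ∀ {c d} → Σ Clause (λ x → Σ Clause λ y → x ∈ X × y ∈ Y × (c , d) ≡ x ∨ᶜ y) → W ⊢ c ≤ d
    case (_ , _ , n₁ , n₂ , refl) = f n₁ n₂

  ⊢-⊔ᴮ : ∀ X Y {e f} → X ⊢ e ≤ f → Y ⊢ e ≤ f → X ⊔ᴮ Y ⊢ e ≤ f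
  ⊢-⊔ᴮ [] Y p q = p
  ⊢-⊔ᴮ ((a , b) ∷ X) Y (p , p′) q =
    ⊢-cut W (⊢-weaken (map ((a , b) ∨ᶜ_) Y) (X ⊔ᴮ Y) (⊢-⊔ᴮ X Y p (⊢-mono Y ≤-refl (x≤x∨y _ _) q)))
            (⊢-map-∨ᶜ Y (⊢-⊔ᴮ X Y p′ (⊢-mono Y (x∧y≤x _ _) ≤-refl q)) (⊢-mono Y (x∧y≤x _ _) ≤-refl q))
    where
    W : List Clause
    W = ((a , b) ∷ X) ⊔ᴮ Y
    -- under the antecedent a, the clause a ⇒ b collapses to b
    ⊢-map-∨ᶜ : ∀ Y {R c d} → R ⊢ c ∧ b ≤ d → Y ⊢ c ∧ a ≤ d → map ((a , b) ∨ᶜ_) Y ++ R ⊢ c ∧ a ≤ d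
    ⊢-map-∨ᶜ [] {R} hR hY = ≤⇒⊢ R hY
    ⊢-map-∨ᶜ ((g , h) ∷ Y) {R} hR (r , s) =
      ⊢-map-∨ᶜ Y (⊢-mono R ≤-refl (x≤x∨y _ _) hR)
                 (⊢-mono Y ≤-refl [x∨y]∧z≤x∨[z∧y] (⊢-∧-greatest Y r (≤⇒⊢ Y (x∧y≤y _ _)))) ,
      ⊢-mono M (∧-distribˡ-∨-≤ _ _ _ ⨾ ∨-monotonic ≤-refl [x∧y]∧z≤[x∧z]∧y) ≤-refl
        (⊢-∨-least M (⊢-weaken (map ((a , b) ∨ᶜ_) Y) R (⊢-mono R [x∧y]∧b≤x∧b ≤-refl hR))
                     (⊢-map-∨ᶜ Y (⊢-mono R [x∧y]∧b≤x∧b ≤-refl hR) (⊢-mono Y [x∧y]∧z≤[x∧z]∧y ≤-refl s)))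
      where
      M : List Clause
      M = map ((a , b) ∨ᶜ_) Y ++ R
      [x∧y]∧b≤x∧b : ∀ {x y} → (x ∧ y) ∧ b ≤ x ∧ b
      [x∧y]∧b≤x∧b = ∧-monotonic (x∧y≤x _ _) ≤-refl

  X⊑X⊔ᴮY : ∀ X Y → X ⊑ X ⊔ᴮ Y
  X⊑X⊔ᴮY X Y = ⊔ᴮ-intro X Y λ m _ → ⊢-apply X m (x∧y≤x _ _) (x≤x∨y _ _)

  Y⊑X⊔ᴮY : ∀ X Y → Y ⊑ X ⊔ᴮ Y
  Y⊑X⊔ᴮY X Y = ⊔ᴮ-intro X Y λ _ m → ⊢-apply Y m (x∧y≤y _ _) (y≤x∨y _ _)

  ⊔ᴮ-least : ∀ {X Y Z} → X ⊑ Z → Y ⊑ Z → X ⊔ᴮ Y ⊑ Z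
  ⊔ᴮ-least {X} {Y} p q = ⊑-intro λ m → ⊢-⊔ᴮ X Y (⊑-elim p m) (⊑-elim q m)

  ⊔ᴮ-comm : ∀ X Y → X ⊔ᴮ Y ⊑ Y ⊔ᴮ X
  ⊔ᴮ-comm X Y = ⊔ᴮ-least (Y⊑X⊔ᴮY Y X) (X⊑X⊔ᴮY Y X)

  ⊔ᴮ-mono : ∀ {X X′ Y Y′} → X ⊑ X′ → Y ⊑ Y′ → X ⊔ᴮ Y ⊑ X′ ⊔ᴮ Y′
  ⊔ᴮ-mono {X′ = X′} {Y′ = Y′} p q =
    ⊔ᴮ-least (⊑-trans p (X⊑X⊔ᴮY X′ Y′)) (⊑-trans q (Y⊑X⊔ᴮY X′ Y′))

  ++-comm : ∀ X Y → X ++ Y ⊑ Y ++ X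
  ++-comm X Y = ++-greatest (X++Y⊑Y X Y) (X++Y⊑X X Y)

  ++-mono : ∀ {X X′ Y Y′} → X ⊑ X′ → Y ⊑ Y′ → X ++ Y ⊑ X′ ++ Y′
  ++-mono {X} {Y = Y} p q = ++-greatest (⊑-trans (X++Y⊑X X Y) p) (⊑-trans (X++Y⊑Y X Y) q)

  ++-distribˡ-⊔ᴮ-⊑ : ∀ X Y Z → X ++ (Y ⊔ᴮ Z) ⊑ (X ++ Y) ⊔ᴮ (X ++ Z)
  ++-distribˡ-⊔ᴮ-⊑ X Y Z = ⊔ᴮ-intro (X ++ Y) (X ++ Z) entails
    where
    W : List Clause
    W = X ++ (Y ⊔ᴮ Z)
    entails : ∀ {a b a′ b′} → (a , b) ∈ X ++ Y → (a′ , b′) ∈ X ++ Z → W ⊢ a ∧ a′ ≤ b ∨ b′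
    entails m n with ∈-++⁻ X m | ∈-++⁻ X n
    ... | inj₁ m′ | _       = ⊢-apply W (∈-++⁺ˡ m′) (x∧y≤x _ _) (x≤x∨y _ _)
    ... | inj₂ _  | inj₁ n′ = ⊢-apply W (∈-++⁺ˡ n′) (x∧y≤y _ _) (y≤x∨y _ _)
    ... | inj₂ m′ | inj₂ n′ = ⊢-apply W (∈-++⁺ʳ X (∈-⊔ᴮ⁺ Y Z m′ n′)) ≤-refl ≤-refl

  ++-distribˡ-⊔ᴮ-⊒ : ∀ X Y Z → (X ++ Y) ⊔ᴮ (X ++ Z) ⊑ X ++ (Y ⊔ᴮ Z)
  ++-distribˡ-⊔ᴮ-⊒ X Y Z = ⊔ᴮ-least
    (++-greatest (X++Y⊑X X Y) (⊑-trans (X++Y⊑Y X Y) (X⊑X⊔ᴮY Y Z)))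
    (++-greatest (X++Y⊑X X Z) (⊑-trans (X++Y⊑Y X Z) (Y⊑X⊔ᴮY Y Z)))

  ⊥ᴮ : List Clause
  ⊥ᴮ = (⊤ , ⊥) ∷ []

  ⊥ᴮ-minimum : ∀ X → ⊥ᴮ ⊑ X
  ⊥ᴮ-minimum X = ⊑-intro λ _ → maximum _ ⨾ y≤x∨y _ _ , x∧y≤y _ _ ⨾ minimum _

  []-maximum : ∀ X → X ⊑ []
  []-maximum X = ⊑-intro λ ()

  -- the complement a ∧ ¬ b of the clause a ⇒ b
  ¬ᶜ : Clause → List Clause
  ¬ᶜ (a , b) = (⊤ , a) ∷ (b , ⊥) ∷ []

  ¬ᴮ : List Clause → List Clause
  ¬ᴮ [] = ⊥ᴮ
  ¬ᴮ (x ∷ X) = ¬ᶜ x ⊔ᴮ ¬ᴮ X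

  clause∧complement≤ : ∀ X {a b c d} → (a , b) ∈ X → (c , d) ∈ ¬ᴮ X → a ∧ c ≤ b ∨ d
  clause∧complement≤ (x ∷ X) m n with ∈-⊔ᴮ⁻ (¬ᶜ x) (¬ᴮ X) n
  clause∧complement≤ (_ ∷ X) (here refl) n | _ , _ , here refl , _ , refl =
    x∧y≤x _ _ ⨾ x≤x∨y _ _ ⨾ y≤x∨y _ _
  clause∧complement≤ (_ ∷ X) (here refl) n | _ , _ , there (here refl) , _ , refl =
    x∧y≤y _ _ ⨾ x∧y≤x _ _ ⨾ x≤x∨y _ _
  clause∧complement≤ (_ ∷ X) (there m) n | _ , _ , _ , k , refl =
    ∧-monotonic ≤-refl (x∧y≤y _ _) ⨾ clause∧complement≤ X m k ⨾ ∨-monotonic ≤-refl (y≤x∨y _ _)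

  ⊔ᴮ-complement : ∀ X → [] ⊑ X ⊔ᴮ ¬ᴮ X
  ⊔ᴮ-complement X = ⊔ᴮ-intro X (¬ᴮ X) (clause∧complement≤ X)

  ++-complement : ∀ X → X ++ ¬ᴮ X ⊑ ⊥ᴮ
  ++-complement [] = ⊑-refl
  ++-complement (x ∷ X) =
    ⊑-trans (++-distribˡ-⊔ᴮ-⊑ (x ∷ X) (¬ᶜ x) (¬ᴮ X))
            (⊔ᴮ-least (clause-contradiction x)
                      (⊑-trans (⊇⇒⊑ there) (++-complement X)))
    where
    clause-contradiction : ∀ x → (x ∷ X) ++ ¬ᶜ x ⊑ ⊥ᴮ
    clause-contradiction (a , b) = ⊑-intro λ { (here refl) →
      ⊢-cut W (⊢-clause W (there (∈-++⁺ʳ X (here refl))) (y≤x∨y _ _) (x∧y≤y _ _ ⨾ y≤x∨y _ _))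
        (⊢-cut W (⊢-clause W (here refl) (x∧y≤y _ _ ⨾ y≤x∨y _ _) (x∧y≤y _ _ ⨾ y≤x∨y _ _))
                 (⊢-clause W (there (∈-++⁺ʳ X (there (here refl)))) (x∧y≤y _ _ ⨾ y≤x∨y _ _) (x∧y≤y _ _))) }
      where
      W : List Clause
      W = ((a , b) ∷ X) ++ ¬ᶜ (a , b)

  ++⊑⊥ᴮ⇒⊑¬ᴮ : ∀ X {Z} → X ++ Z ⊑ ⊥ᴮ → Z ⊑ ¬ᴮ X
  ++⊑⊥ᴮ⇒⊑¬ᴮ X {Z} h =
    ⊑-trans (++-greatest ⊑-refl (⊑-trans ([]-maximum Z) (⊔ᴮ-complement X)))
   (⊑-trans (++-distribˡ-⊔ᴮ-⊑ Z X (¬ᴮ X))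
            (⊔ᴮ-least (⊑-trans (++-comm Z X) (⊑-trans h (⊥ᴮ-minimum (¬ᴮ X))))
                      (X++Y⊑Y Z (¬ᴮ X))))

  ¬ᴮ-antitone : ∀ {X Y} → X ⊑ Y → ¬ᴮ Y ⊑ ¬ᴮ X
  ¬ᴮ-antitone {X} {Y} p =
    ++⊑⊥ᴮ⇒⊑¬ᴮ X (⊑-trans (++-mono p ⊑-refl) (++-complement Y))

  X⊑¬ᴮ¬ᴮX : ∀ X → X ⊑ ¬ᴮ (¬ᴮ X)
  X⊑¬ᴮ¬ᴮX X = ++⊑⊥ᴮ⇒⊑¬ᴮ (¬ᴮ X) (⊑-trans (++-comm (¬ᴮ X) X) (++-complement X))

  ++-distribˡ-⊔ᴮ : ∀ X Y Z → X ++ (Y ⊔ᴮ Z) ≃ (X ++ Y) ⊔ᴮ (X ++ Z)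
  ++-distribˡ-⊔ᴮ X Y Z = ++-distribˡ-⊔ᴮ-⊑ X Y Z , ++-distribˡ-⊔ᴮ-⊒ X Y Z

  orderLattice : OrderLattice.DistributiveLattice α (α ⊔ ℓ₂) (α ⊔ ℓ₂)
  orderLattice = record
    { Carrier = List Clause ; _≈_ = _≃_ ; _≤_ = _⊑_ ; _∨_ = _⊔ᴮ_ ; _∧_ = _++_
    ; isDistributiveLattice = record
      { isLattice = record
        { isPartialOrder = record
          { isPreorder = record
            { isEquivalence = record { refl = ≃-refl ; sym = ≃-sym ; trans = ≃-trans }
            ; reflexive = proj₁
            ; trans = ⊑-trans }
          ; antisym = _,_ }
        ; supremum = λ X Y → X⊑X⊔ᴮY X Y , Y⊑X⊔ᴮY X Y , λ _ → ⊔ᴮ-least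
        ; infimum = λ X Y → X++Y⊑X X Y , X++Y⊑Y X Y , λ _ → ++-greatest }
      ; ∧-distribˡ-∨ = ++-distribˡ-⊔ᴮ } }

  booleanExtension : BooleanAlgebra α (α ⊔ ℓ₂)
  booleanExtension = record
    { Carrier = List Clause ; _≈_ = _≃_ ; _∨_ = _⊔ᴮ_ ; _∧_ = _++_ ; ¬_ = ¬ᴮ ; ⊤ = [] ; ⊥ = ⊥ᴮ
    ; isBooleanAlgebra = record
      { isDistributiveLattice = record
        { isLattice =
            OrderLatticeProperties.isAlgLattice (OrderLattice.DistributiveLattice.lattice orderLattice)
        ; ∨-distrib-∧ = DistributiveLatticeProperties.∨-distrib-∧ orderLattice
        ; ∧-distrib-∨ = DistributiveLatticeProperties.∧-distrib-∨ orderLattice }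
      ; ∨-complement = (λ X → []-maximum _ , ⊑-trans (⊔ᴮ-complement X) (⊔ᴮ-comm X (¬ᴮ X))) ,
                       (λ X → []-maximum _ , ⊔ᴮ-complement X)
      ; ∧-complement = (λ X → ⊑-trans (++-comm (¬ᴮ X) X) (++-complement X) , ⊥ᴮ-minimum _) ,
                       (λ X → ++-complement X , ⊥ᴮ-minimum _)
      ; ¬-cong = λ (p , q) → ¬ᴮ-antitone q , ¬ᴮ-antitone p } }

  interior : List Clause → Carrier
  interior [] = ⊤
  interior ((a , b) ∷ X) = (a ⇨ b) ∧ interior X

  embed : Carrier → List Clause
  embed a = (⊤ , a) ∷ []

  □ᴮ : List Clause → List Clause
  □ᴮ X = embed (interior X)

  ◇ᴮ : List Clause → List Clause
  ◇ᴮ X = ¬ᴮ (□ᴮ (¬ᴮ X))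

  ⊢-interior : ∀ X {c d} → X ⊢ c ≤ d → c ∧ interior X ≤ d
  ⊢-interior [] p = x∧y≤x _ _ ⨾ p
  ⊢-interior ((a , b) ∷ X) {c} {d} (p , q) =
    ∧-greatest (∧-monotonic ≤-refl (x∧y≤y _ _) ⨾ ⊢-interior X p) ≤-refl ⨾ ∧-distribʳ-∨-≤ ⨾
    ∨-least (x∧y≤x _ _) (under-a ⨾ ⊢-interior X q)
    where
    under-a : a ∧ (c ∧ ((a ⇨ b) ∧ interior X)) ≤ (c ∧ b) ∧ interior X
    under-a = ∧-greatest (∧-greatest (x∧y≤y _ _ ⨾ x∧y≤x _ _)
                                     (∧-greatest (x∧y≤y _ _ ⨾ x∧y≤y _ _ ⨾ x∧y≤x _ _) (x∧y≤x _ _) ⨾ ⇨-eval))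
                         (x∧y≤y _ _ ⨾ x∧y≤y _ _ ⨾ x∧y≤y _ _)

  interior-∈ : ∀ X {a b} → (a , b) ∈ X → interior X ≤ a ⇨ b
  interior-∈ (_ ∷ X) (here refl) = x∧y≤x _ _
  interior-∈ (_ ∷ X) (there m) = x∧y≤y _ _ ⨾ interior-∈ X m

  interior-mono : ∀ {X Y} → X ⊑ Y → interior X ≤ interior Y
  interior-mono {Y = []} _ = maximum _
  interior-mono {X} {Y = _ ∷ Y} p =
    ∧-greatest (transpose-⇨ (∧-comm-≤ ⨾ ⊢-interior X (⊑-elim p (here refl))))
               (interior-mono (⊑-tail p))

  embed-mono : ∀ {a b} → a ≤ b → embed a ⊑ embed b
  embed-mono p = ⊑-intro λ { (here refl) → maximum _ ⨾ y≤x∨y _ _ , x∧y≤y _ _ ⨾ p }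

  embed-reflects-≤ : ∀ {a b} → embed a ⊑ embed b → a ≤ b
  embed-reflects-≤ p = ∧-greatest (maximum _) ≤-refl ⨾ proj₂ (⊑-elim p (here refl))

  embed-cong : ∀ {a b} → a ≈ b → embed a ≃ embed b
  embed-cong e = embed-mono (reflexive e) , embed-mono (reflexive (Eq.sym e))

  ≤-interior-embed : ∀ {a} → a ≤ interior (embed a)
  ≤-interior-embed = ∧-greatest (transpose-⇨ (x∧y≤x _ _)) (maximum _)

  interior-embed-≤ : ∀ {a} → interior (embed a) ≤ a
  interior-embed-≤ = x∧y≤x _ _ ⨾ ∧-greatest ≤-refl (maximum _) ⨾ ⇨-eval

  □ᴮ-deflationary : ∀ X → □ᴮ X ⊑ X
  □ᴮ-deflationary X = ⊑-intro λ m →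
    maximum _ ⨾ y≤x∨y _ _ , ∧-comm-≤ ⨾ transpose-∧ (interior-∈ X m)

  □ᴮ-mono : ∀ {X Y} → X ⊑ Y → □ᴮ X ⊑ □ᴮ Y
  □ᴮ-mono p = embed-mono (interior-mono p)

  □ᴮX⊑□ᴮ□ᴮX : ∀ X → □ᴮ X ⊑ □ᴮ (□ᴮ X)
  □ᴮX⊑□ᴮ□ᴮX X = embed-mono ≤-interior-embed

  embed-open : ∀ a → □ᴮ (embed a) ≃ embed a
  embed-open a = embed-mono interior-embed-≤ , embed-mono ≤-interior-embed

  embed-∧ : ∀ a b → embed (a ∧ b) ≃ embed a ++ embed b
  embed-∧ a b =
    ++-greatest (embed-mono (x∧y≤x _ _)) (embed-mono (x∧y≤y _ _)) ,
    ⊑-intro λ { (here refl) →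
      (maximum _ ⨾ y≤x∨y _ _ , maximum _ ⨾ y≤x∨y _ _) ,
      (maximum _ ⨾ y≤x∨y _ _ , ∧-monotonic (x∧y≤y _ _) ≤-refl) }

  embed-∨ : ∀ a b → embed (a ∨ b) ≃ embed a ⊔ᴮ embed b
  embed-∨ a b =
    ⊑-intro (λ { (here refl) → maximum _ ⨾ y≤x∨y _ _ , x∧y≤y _ _ }) ,
    ⊔ᴮ-least (embed-mono (x≤x∨y _ _)) (embed-mono (y≤x∨y _ _))

  □ᴮ-∧-⊒ : ∀ X Y → □ᴮ X ++ □ᴮ Y ⊑ □ᴮ (X ++ Y)
  □ᴮ-∧-⊒ X Y =
    ⊑-trans (proj₂ (embed-∧ (interior X) (interior Y)))
            (embed-mono (≤-interior-embed ⨾ interior-mono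
              (++-greatest (⊑-trans (embed-mono (x∧y≤x _ _)) (□ᴮ-deflationary X))
                           (⊑-trans (embed-mono (x∧y≤y _ _)) (□ᴮ-deflationary Y)))))

  embed-⊤ : embed ⊤ ≃ []
  embed-⊤ = []-maximum _ , ⊑-intro λ { (here refl) → ≤-refl }

  ⊑⇒++≃ : ∀ {X Y} → X ⊑ Y → X ++ Y ≃ X
  ⊑⇒++≃ {X} {Y} p = X++Y⊑X X Y , ++-greatest ⊑-refl p

  ++≃⇒⊑ : ∀ {X Y} → X ++ Y ≃ X → X ⊑ Y
  ++≃⇒⊑ {X} {Y} p = ⊑-trans (proj₂ p) (X++Y⊑Y X Y)

  interiorAlgebra : TBA α (α ⊔ ℓ₂)
  interiorAlgebra = record
    { boolean = booleanExtension
    ; □ = □ᴮ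
    ; □-cong = λ (p , q) → □ᴮ-mono p , □ᴮ-mono q
    ; □-⊤ = embed-⊤
    ; □-∧ = λ X Y → ++-greatest (□ᴮ-mono (X++Y⊑X X Y)) (□ᴮ-mono (X++Y⊑Y X Y)) , □ᴮ-∧-⊒ X Y
    ; □-deflationary = λ X → ⊑⇒++≃ (□ᴮ-deflationary X)
    ; □-4 = λ X → ⊑⇒++≃ (□ᴮX⊑□ᴮ□ᴮX X)
    }

  X⊑◇ᴮX : ∀ X → X ⊑ ◇ᴮ X
  X⊑◇ᴮX X = ++⊑⊥ᴮ⇒⊑¬ᴮ (□ᴮ (¬ᴮ X))
    (⊑-trans (++-mono (□ᴮ-deflationary (¬ᴮ X)) ⊑-refl)
             (⊑-trans (++-comm (¬ᴮ X) X) (++-complement X)))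

  ◇ᴮ-mono : ∀ {X Y} → X ⊑ Y → ◇ᴮ X ⊑ ◇ᴮ Y
  ◇ᴮ-mono p = ¬ᴮ-antitone (□ᴮ-mono (¬ᴮ-antitone p))

  ◇ᴮ◇ᴮX⊑◇ᴮX : ∀ X → ◇ᴮ (◇ᴮ X) ⊑ ◇ᴮ X
  ◇ᴮ◇ᴮX⊑◇ᴮX X =
    ¬ᴮ-antitone (⊑-trans (□ᴮX⊑□ᴮ□ᴮX (¬ᴮ X)) (□ᴮ-mono (X⊑¬ᴮ¬ᴮX (□ᴮ (¬ᴮ X)))))

  ¬ᴮembed⊔ᴮembed≃clause : ∀ a c → ¬ᴮ (embed a) ⊔ᴮ embed c ≃ (a , c) ∷ []
  ¬ᴮembed⊔ᴮembed≃clause a c =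
    ⊑-intro (λ { (here refl) →
      ⊢-clause E (there (here refl)) (∧-greatest (∧-greatest ≤-refl (maximum _)) (maximum _) ⨾ y≤x∨y _ _)
                                     (x∧y≤y _ _ ⨾ ∨-least (∨-least (minimum _) (minimum _)) ≤-refl) }) ,
    ⊑-intro (λ { (here refl) → ≤⇒⊢ ((a , c) ∷ []) (maximum _ ⨾ x≤x∨y _ _ ⨾ x≤x∨y _ _)
               ; (there (here refl)) →
                   ⊢-clause ((a , c) ∷ []) (here refl)
                     (x∧y≤x _ _ ⨾ x∧y≤x _ _ ⨾ y≤x∨y _ _) (x∧y≤y _ _ ⨾ y≤x∨y _ _) })
    where
    E : List Clause
    E = ¬ᴮ (embed a) ⊔ᴮ embed c

  embed-⇨ : ∀ a c → embed (a ⇨ c) ≃ □ᴮ (¬ᴮ (embed a) ⊔ᴮ embed c)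
  embed-⇨ a c =
    ⊑-trans (embed-mono (∧-greatest ≤-refl (maximum _))) (□ᴮ-mono (proj₂ (¬ᴮembed⊔ᴮembed≃clause a c))) ,
    ⊑-trans (□ᴮ-mono (proj₁ (¬ᴮembed⊔ᴮembed≃clause a c))) (embed-mono (x∧y≤x _ _))

  embed-¬ : ∀ a → embed (a ⇨ ⊥) ≃ □ᴮ (¬ᴮ (embed a))
  embed-¬ a =
    ⊑-trans (proj₁ (embed-⇨ a ⊥)) (□ᴮ-mono (⊔ᴮ-least ⊑-refl (⊥ᴮ-minimum (¬ᴮ (embed a))))) ,
    ⊑-trans (□ᴮ-mono (X⊑X⊔ᴮY (¬ᴮ (embed a)) ⊥ᴮ)) (proj₂ (embed-⇨ a ⊥))

  □ᴮ◇ᴮembed⊑embed¬¬ : ∀ d → □ᴮ (◇ᴮ (embed d)) ⊑ embed ((d ⇨ ⊥) ⇨ ⊥)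
  □ᴮ◇ᴮembed⊑embed¬¬ d =
    ⊑-trans (□ᴮ-mono (¬ᴮ-antitone (proj₁ (embed-¬ d)))) (proj₂ (embed-¬ (d ⇨ ⊥)))

module ClosedIdealRepresentation
  {α ℓ₁ ℓ₂ ℓ} (A : HeytingAlgebra α ℓ₁ ℓ₂) (∇ Δ : Pred (HeytingAlgebra.Carrier A) ℓ)
  (∇-filter : HA.IsFilter A ∇) (Δ-ideal : HA.IsIdeal A Δ)
  (dense⊆∇ : ∀ {a} → HA.Dense A a → ∇ a) (Δ-closed : HA.ClosedIdeal A Δ) where

  open HeytingLattice A
  open BooleanExtension A
  private
    module ∇ = HA.IsFilter ∇-filter
    module Δ = HA.IsIdeal Δ-ideal
    module B = TBA interiorAlgebra

  ∇′ : Pred (List Clause) (α ⊔ ℓ₂ ⊔ ℓ)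
  ∇′ X = Σ Carrier λ n → ∇ n × embed n ⊑ X

  Δ′ : Pred (List Clause) (α ⊔ ℓ₂ ⊔ ℓ)
  Δ′ X = Σ Carrier λ d → Δ d × X ⊑ ◇ᴮ (embed d)

  ∇′-open : B.IsOpenFilter ∇′
  ∇′-open = record
    { isFilter = record
      { ⊤∈ = ⊤ , ∇.⊤∈ , []-maximum _
      ; ∧-closed = λ (n₁ , n₁∈∇ , p₁) (n₂ , n₂∈∇ , p₂) →
          n₁ ∧ n₂ , ∇.∧-closed n₁∈∇ n₂∈∇ , ⊑-trans (proj₁ (embed-∧ n₁ n₂)) (++-mono p₁ p₂)
      ; up = λ X≤Y (n , n∈∇ , q) → n , n∈∇ , ⊑-trans q (++≃⇒⊑ X≤Y) }
    ; □-closed = λ (n , n∈∇ , q) → n , n∈∇ , ⊑-trans (proj₂ (embed-open n)) (□ᴮ-mono q) }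

  Δ′-closed : B.IsClosedIdeal Δ′
  Δ′-closed = record
    { isIdeal = record
      { ⊥∈ = ⊥ , Δ.⊥∈ , ⊥ᴮ-minimum _
      ; ∨-closed = λ (d₁ , d₁∈Δ , p₁) (d₂ , d₂∈Δ , p₂) →
          d₁ ∨ d₂ , Δ.∨-closed d₁∈Δ d₂∈Δ ,
          ⊔ᴮ-least (⊑-trans p₁ (◇ᴮ-mono (embed-mono (x≤x∨y _ _))))
                   (⊑-trans p₂ (◇ᴮ-mono (embed-mono (y≤x∨y _ _))))
      ; down = λ Y≤X (d , d∈Δ , q) → d , d∈Δ , ⊑-trans (++≃⇒⊑ Y≤X) q }
    ; ◇-closed = λ (d , d∈Δ , q) → d , d∈Δ , ⊑-trans (◇ᴮ-mono q) (◇ᴮ◇ᴮX⊑◇ᴮX (embed d)) }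

  open B.Twist ∇′ Δ′ using (G₂; Γ; Λ)

  Γ⊆Λ : ∀ {X} → Γ X → Λ X
  Γ⊆Λ {X} (_ , _ , X-open , _) =
    X-open , m ∨ (m ⇨ ⊥) , dense⊆∇ (∨-dense (∧-comm-≤ ⨾ ⇨-eval)) ,
    ⊑-trans (proj₁ (embed-∨ m (m ⇨ ⊥)))
            (⊔ᴮ-mono (□ᴮ-deflationary X)
                     (⊑-trans (proj₁ (embed-¬ m)) (□ᴮ-mono (¬ᴮ-antitone (proj₂ X-open)))))
    where
    m : Carrier
    m = interior X

  Λ⊆Γ : ∀ {X} → Λ X → Γ X
  Λ⊆Γ {X} (X-open , X∨□¬X∈∇′) =
    □ᴮ (¬ᴮ X) ,
    (X∨□¬X∈∇′ , ⊥ , Δ.⊥∈ ,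
     ⊑-trans (++-mono ⊑-refl (□ᴮ-deflationary (¬ᴮ X))) (⊑-trans (++-complement X) (⊥ᴮ-minimum _))) ,
    X-open , embed-open (interior (¬ᴮ X))

  -- the only place where closedness of Δ is needed: □◇d lies below ¬¬d
  interiors∈Tw : ∀ {X Y} → G₂ (X , Y) → ∇ (interior X ∨ interior Y) × Δ (interior X ∧ interior Y)
  interiors∈Tw {X} {Y} (((n , n∈∇ , n⊑) , (d , d∈Δ , ⊑◇d)) , X-open , Y-open) =
    ∇.up (embed-reflects-≤ (⊑-trans n⊑ (⊑-trans (⊔ᴮ-mono (proj₂ X-open) (proj₂ Y-open))
                                                (proj₂ (embed-∨ _ _))))) n∈∇ ,
    Δ.down (embed-reflects-≤ (⊑-trans (proj₂ (embed-open _))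
                              (⊑-trans (□ᴮ-mono (⊑-trans meet⊑X++Y ⊑◇d)) (□ᴮ◇ᴮembed⊑embed¬¬ d))))
           (Δ-closed d∈Δ)
    where
    meet⊑X++Y : embed (interior X ∧ interior Y) ⊑ X ++ Y
    meet⊑X++Y = ⊑-trans (proj₁ (embed-∧ _ _)) (++-mono (proj₁ X-open) (proj₁ Y-open))

  embedding : Iso (TwHA A ∇ Δ) (G₂Alg interiorAlgebra ∇′ Δ′)
  embedding = record
    { f = λ (a , b) → embed a , embed b
    ; f-U = λ { {a , b} (a∨b∈∇ , a∧b∈Δ) →
        ((a ∨ b , a∨b∈∇ , proj₁ (embed-∨ a b)) ,
         (a ∧ b , a∧b∈Δ , ⊑-trans (proj₂ (embed-∧ a b)) (X⊑◇ᴮX (embed (a ∧ b))))) ,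
        embed-open a , embed-open b }
    ; f-cong = λ _ _ (a≈a′ , b≈b′) → embed-cong a≈a′ , embed-cong b≈b′
    ; f-inj = λ _ _ ((p , p′) , (q , q′)) →
        antisym (embed-reflects-≤ p) (embed-reflects-≤ p′) ,
        antisym (embed-reflects-≤ q) (embed-reflects-≤ q′)
    ; f-surj = λ { {X , Y} g@(_ , X-open , Y-open) →
        (interior X , interior Y) , interiors∈Tw g , X-open , Y-open }
    ; f-∨ = λ { {a , b} {c , d} _ _ → embed-∨ a c , embed-∧ b d }
    ; f-∧ = λ { {a , b} {c , d} _ _ → embed-∧ a c , embed-∨ b d }
    ; f-→ = λ { {a , b} {c , d} _ _ → embed-⇨ a c , embed-∧ a d }
    ; f-⊥ = ≃-refl , embed-⊤
    ; f-∼ = λ _ → ≃-refl , ≃-refl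
    }

  representation : OpenPairRep A ∇ Δ
  representation = record
    { B = interiorAlgebra ; ∇′ = ∇′ ; Δ′ = Δ′
    ; ∇′-open = ∇′-open ; Δ′-closed = Δ′-closed
    ; Γ⊆Λ = Γ⊆Λ ; Λ⊆Γ = Λ⊆Γ ; iso = embedding }

module TwistStructure
  {α ℓ₁ ℓ₂ ℓ} (A : HeytingAlgebra α ℓ₁ ℓ₂) (∇ Δ : Pred (HeytingAlgebra.Carrier A) ℓ)
  (∇-filter : HA.IsFilter A ∇) (Δ-ideal : HA.IsIdeal A Δ)
  (dense⊆∇ : ∀ {a} → HA.Dense A a → ∇ a) where

  open HeytingLattice A
  private
    module ∇ = HA.IsFilter ∇-filter
    module Δ = HA.IsIdeal Δ-ideal
  open PairAlg (TwHA A ∇ Δ) public using ()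
    renaming (U to Tw; _→ᵗ_ to _⇒_; ∼ᵗ to ∼_; ⊥ᵗ to ⊥ᵗ; _≈_ to _≈ᵗ_)

  ⊥ᵗ∈Tw : Tw ⊥ᵗ
  ⊥ᵗ∈Tw = ∇.up (y≤x∨y _ _) ∇.⊤∈ , Δ.down (x∧y≤x _ _) Δ.⊥∈

  ∼-closed : ∀ {x} → Tw x → Tw (∼ x)
  ∼-closed (b∨a∈∇ , b∧a∈Δ) = ∇.up (∨-least (y≤x∨y _ _) (x≤x∨y _ _)) b∨a∈∇ , Δ.down ∧-comm-≤ b∧a∈Δ

  ⇒-closed : ∀ {x y} → Tw x → Tw y → Tw (x ⇒ y)
  ⇒-closed {a , b} {c , d} _ (c∨d∈∇ , c∧d∈Δ) =
    ∇.up distrib (∇.∧-closed (dense⊆∇ (∨-dense ¬[a⇨c]∧¬a≤⊥)) c∨d∈∇) ,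
    Δ.down (∧-greatest (∧-monotonic ≤-refl (x∧y≤x _ _) ⨾ ⇨-eval) (x∧y≤y _ _ ⨾ x∧y≤y _ _)) c∧d∈Δ
    where
    ¬[a⇨c]∧¬a≤⊥ : ((a ⇨ c) ⇨ ⊥) ∧ (a ⇨ ⊥) ≤ ⊥
    ¬[a⇨c]∧¬a≤⊥ = ∧-monotonic ≤-refl (transpose-⇨ (⇨-eval ⨾ minimum _)) ⨾ ⇨-eval
    distrib : ((a ⇨ c) ∨ a) ∧ (c ∨ d) ≤ (a ⇨ c) ∨ (a ∧ d)
    distrib = ∧-distribʳ-∨-≤ ⨾
      ∨-least (x∧y≤x _ _ ⨾ x≤x∨y _ _)
              (∧-distribˡ-∨-≤ _ _ _ ⨾ ∨-least (x∧y≤y _ _ ⨾ transpose-⇨ (x∧y≤x _ _) ⨾ x≤x∨y _ _) (y≤x∨y _ _))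

  ⇒⊥ᵗ≈⊥ᵗ⇒⊤≤₁ : ∀ x → (x ⇒ ⊥ᵗ) ≈ᵗ ⊥ᵗ → ⊤ ≤ proj₁ x
  ⇒⊥ᵗ≈⊥ᵗ⇒⊤≤₁ _ (_ , e) = reflexive (Eq.sym e) ⨾ x∧y≤x _ _

  ⊤≤₁⇒⇒⊥ᵗ≈⊥ᵗ : ∀ x → ⊤ ≤ proj₁ x → (x ⇒ ⊥ᵗ) ≈ᵗ ⊥ᵗ
  ⊤≤₁⇒⇒⊥ᵗ≈⊥ᵗ _ h =
    antisym (∧-greatest ≤-refl (maximum _ ⨾ h) ⨾ ⇨-eval) (minimum _) ,
    antisym (maximum _) (∧-greatest h ≤-refl)

module OpenPairs {cB ℓB pB} (B : TBA cB ℓB) (∇′ Δ′ : Pred (TBA.Carrier B) pB) where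

  private
    module 𝔹 where
      open TBA B public
      open BooleanProperties boolean public using (∧-identityʳ; ∨-identityʳ; ¬⊤≈⊥; ∧-zeroʳ)
  open PairAlg (G₂Alg B ∇′ Δ′) public using () renaming (_→ᵗ_ to _⇒ᴳ_; ⊥ᵗ to ⊥ᴳ; _≈_ to _≈ᴳ_)

  ≈ᴳ-sym : ∀ {x y} → x ≈ᴳ y → y ≈ᴳ x
  ≈ᴳ-sym (e₁ , e₂) = 𝔹.sym e₁ , 𝔹.sym e₂

  ≈ᴳ-trans : ∀ {x y z} → x ≈ᴳ y → y ≈ᴳ z → x ≈ᴳ z
  ≈ᴳ-trans (e₁ , e₂) (e₃ , e₄) = 𝔹.trans e₁ e₃ , 𝔹.trans e₂ e₄

  ⇒ᴳ-cong : ∀ {x x′ y y′} → x ≈ᴳ x′ → y ≈ᴳ y′ → (x ⇒ᴳ y) ≈ᴳ (x′ ⇒ᴳ y′)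
  ⇒ᴳ-cong (e₁ , _) (e₃ , e₄) = 𝔹.□-cong (𝔹.∨-cong (𝔹.¬-cong e₁) e₃) , 𝔹.∧-cong e₁ e₄

  □⊥≈⊥ : 𝔹.□ 𝔹.⊥ 𝔹.≈ 𝔹.⊥
  □⊥≈⊥ = 𝔹.trans (𝔹.sym (𝔹.□-deflationary 𝔹.⊥)) (𝔹.∧-zeroʳ _)

  ⇒ᴳ⊥ᴳ≈⊥ᴳ⇒≈⊤₁ : ∀ y → (y ⇒ᴳ ⊥ᴳ) ≈ᴳ ⊥ᴳ → proj₁ y 𝔹.≈ 𝔹.⊤
  ⇒ᴳ⊥ᴳ≈⊥ᴳ⇒≈⊤₁ _ (_ , e) = 𝔹.trans (𝔹.sym (𝔹.∧-identityʳ _)) e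

  ≈⊤₁⇒⇒ᴳ⊥ᴳ≈⊥ᴳ : ∀ y → proj₁ y 𝔹.≈ 𝔹.⊤ → (y ⇒ᴳ ⊥ᴳ) ≈ᴳ ⊥ᴳ
  ≈⊤₁⇒⇒ᴳ⊥ᴳ≈⊥ᴳ _ e =
    𝔹.trans (𝔹.□-cong (𝔹.trans (𝔹.∨-identityʳ _) (𝔹.trans (𝔹.¬-cong e) 𝔹.¬⊤≈⊥))) □⊥≈⊥ ,
    𝔹.trans (𝔹.∧-identityʳ _) e

module RepresentationClosesIdeal
  {α ℓ₁ ℓ₂ ℓ} (A : HeytingAlgebra α ℓ₁ ℓ₂) (∇ Δ : Pred (HeytingAlgebra.Carrier A) ℓ)
  (∇-filter : HA.IsFilter A ∇) (Δ-ideal : HA.IsIdeal A Δ)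
  (dense⊆∇ : ∀ {a} → HA.Dense A a → ∇ a) (R : OpenPairRep A ∇ Δ) where

  open HeytingLattice A
  open TwistStructure A ∇ Δ ∇-filter Δ-ideal dense⊆∇
  open OpenPairRep R
  open OpenPairs B ∇′ Δ′
  private
    module ∇ = HA.IsFilter ∇-filter
    module Δ = HA.IsIdeal Δ-ideal
    module 𝔹 where
      open TBA B public
      open BooleanProperties boolean public using (∧-identityʳ; ∨-identityʳ; ∨-zeroʳ; ∧-idem)
    module ∇′ = 𝔹.IsFilter (𝔹.IsOpenFilter.isFilter ∇′-open)
    module Δ′ = 𝔹.IsClosedIdeal Δ′-closed
    module Δ′-ideal = 𝔹.IsIdeal Δ′.isIdeal
  open Iso iso using (f; f-U; f-cong; f-inj; f-surj; f-→; f-⊥; f-∼)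

  f-⇒⊥ᵗ : ∀ x → Tw x → f (x ⇒ ⊥ᵗ) ≈ᴳ (f x ⇒ᴳ ⊥ᴳ)
  f-⇒⊥ᵗ x x∈Tw = ≈ᴳ-trans (f-→ {x} x∈Tw ⊥ᵗ∈Tw) (⇒ᴳ-cong {f x} (𝔹.refl , 𝔹.refl) f-⊥)

  f-preserves-⊤₁ : ∀ x → Tw x → ⊤ ≤ proj₁ x → proj₁ (f x) 𝔹.≈ 𝔹.⊤
  f-preserves-⊤₁ x x∈Tw h = ⇒ᴳ⊥ᴳ≈⊥ᴳ⇒≈⊤₁ (f x)
    (≈ᴳ-trans (≈ᴳ-sym (f-⇒⊥ᵗ x x∈Tw))
              (≈ᴳ-trans (f-cong {x ⇒ ⊥ᵗ} (⇒-closed {x} x∈Tw ⊥ᵗ∈Tw) ⊥ᵗ∈Tw (⊤≤₁⇒⇒⊥ᵗ≈⊥ᵗ x h)) f-⊥))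

  f-reflects-⊤₁ : ∀ x → Tw x → proj₁ (f x) 𝔹.≈ 𝔹.⊤ → ⊤ ≤ proj₁ x
  f-reflects-⊤₁ x x∈Tw e = ⇒⊥ᵗ≈⊥ᵗ⇒⊤≤₁ x
    (f-inj {x ⇒ ⊥ᵗ} (⇒-closed {x} x∈Tw ⊥ᵗ∈Tw) ⊥ᵗ∈Tw
           (≈ᴳ-trans (f-⇒⊥ᵗ x x∈Tw) (≈ᴳ-trans (≈⊤₁⇒⇒ᴳ⊥ᴳ≈⊥ᴳ (f x) e) (≈ᴳ-sym f-⊥))))

  module _ {a} (a∈Δ : Δ a) where
    u : Carrier × Carrier
    u = a , ⊤

    u∈Tw : Tw u
    u∈Tw = ∇.up (y≤x∨y _ _) ∇.⊤∈ , Δ.down (x∧y≤x _ _) a∈Δ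

    p q : 𝔹.Carrier
    p = proj₁ (f u)
    q = proj₂ (f u)

    q≈⊤ : q 𝔹.≈ 𝔹.⊤
    q≈⊤ = 𝔹.trans (𝔹.sym (proj₁ (f-∼ {u} u∈Tw))) (f-preserves-⊤₁ (∼ u) (∼-closed {u} u∈Tw) ≤-refl)

    p∈Δ′ : Δ′ p
    p∈Δ′ = Δ′-ideal.down p≤p∧q (proj₂ (proj₁ (f-U {u} u∈Tw)))
      where
      open SetoidReasoning 𝔹.setoid
      p≤p∧q : p 𝔹.≤ (p 𝔹.∧ q)
      p≤p∧q = begin
        p 𝔹.∧ (p 𝔹.∧ q)     ≈⟨ 𝔹.∧-cong 𝔹.refl (𝔹.∧-cong 𝔹.refl q≈⊤) ⟩
        p 𝔹.∧ (p 𝔹.∧ 𝔹.⊤)   ≈⟨ 𝔹.∧-cong 𝔹.refl (𝔹.∧-identityʳ p) ⟩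
        p 𝔹.∧ p             ≈⟨ 𝔹.∧-idem p ⟩
        p                   ∎

    s : 𝔹.Carrier
    s = 𝔹.□ (𝔹.◇ p)

    s⊤∈G₂ : TBA.Twist.G₂ B ∇′ Δ′ (s , 𝔹.⊤)
    s⊤∈G₂ =
      (∇′.up (𝔹.trans (𝔹.∧-cong 𝔹.refl (𝔹.∨-zeroʳ s)) (𝔹.∧-identityʳ 𝔹.⊤)) ∇′.⊤∈ ,
       Δ′-ideal.down s∧⊤≤◇p (Δ′.◇-closed p∈Δ′)) ,
      □s≈s , 𝔹.□-⊤
      where
      open SetoidReasoning 𝔹.setoid
      s∧⊤≤◇p : (s 𝔹.∧ 𝔹.⊤) 𝔹.≤ 𝔹.◇ p
      s∧⊤≤◇p = begin
        (s 𝔹.∧ 𝔹.⊤) 𝔹.∧ 𝔹.◇ p  ≈⟨ 𝔹.∧-cong (𝔹.∧-identityʳ s) 𝔹.refl ⟩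
        s 𝔹.∧ 𝔹.◇ p            ≈⟨ 𝔹.□-deflationary (𝔹.◇ p) ⟩
        s                      ≈⟨ 𝔹.∧-identityʳ s ⟨
        s 𝔹.∧ 𝔹.⊤              ∎
      □s≈s : 𝔹.□ s 𝔹.≈ s
      □s≈s = begin
        𝔹.□ s              ≈⟨ 𝔹.□-deflationary s ⟨
        𝔹.□ s 𝔹.∧ s        ≈⟨ 𝔹.∧-comm _ _ ⟩
        s 𝔹.∧ 𝔹.□ s        ≈⟨ 𝔹.□-4 (𝔹.◇ p) ⟩
        s                  ∎

    ¬¬u : Carrier × Carrier
    ¬¬u = (u ⇒ ⊥ᵗ) ⇒ ⊥ᵗ

    ¬¬u∈Tw : Tw ¬¬u
    ¬¬u∈Tw = ⇒-closed {u ⇒ ⊥ᵗ} (⇒-closed {u} u∈Tw ⊥ᵗ∈Tw) ⊥ᵗ∈Tw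

    f¬¬u₁≈s : proj₁ (f ¬¬u) 𝔹.≈ s
    f¬¬u₁≈s = 𝔹.trans
      (proj₁ (≈ᴳ-trans (f-⇒⊥ᵗ (u ⇒ ⊥ᵗ) (⇒-closed {u} u∈Tw ⊥ᵗ∈Tw))
                       (⇒ᴳ-cong {f (u ⇒ ⊥ᵗ)} (f-⇒⊥ᵗ u u∈Tw) (𝔹.refl , 𝔹.refl))))
      (𝔹.□-cong (𝔹.trans (𝔹.∨-identityʳ _) (𝔹.¬-cong (𝔹.□-cong (𝔹.∨-identityʳ _)))))

    ¬¬a≤preimage : ∀ z → Tw z → f z ≈ᴳ (s , 𝔹.⊤) → (a ⇨ ⊥) ⇨ ⊥ ≤ proj₁ z ∧ proj₂ z
    ¬¬a≤preimage z z∈Tw (fz₁≈s , fz₂≈⊤) =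
      ∧-greatest (⊤≤⇨⇒≤ (f-reflects-⊤₁ (¬¬u ⇒ z) (⇒-closed {¬¬u} ¬¬u∈Tw z∈Tw) ¬¬u⇒z-valid))
                 (maximum _ ⨾ f-reflects-⊤₁ (∼ z) (∼-closed {z} z∈Tw) (𝔹.trans (proj₁ (f-∼ {z} z∈Tw)) fz₂≈⊤))
      where
      ¬¬u⇒z-valid : proj₁ (f (¬¬u ⇒ z)) 𝔹.≈ 𝔹.⊤
      ¬¬u⇒z-valid = 𝔹.trans (proj₁ (f-→ {¬¬u} {z} ¬¬u∈Tw z∈Tw))
        (𝔹.trans (𝔹.□-cong (𝔹.trans (𝔹.∨-cong (𝔹.¬-cong f¬¬u₁≈s) fz₁≈s) (𝔹.∨-complementˡ s))) 𝔹.□-⊤)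

  Δ-closed : HA.ClosedIdeal A Δ
  Δ-closed a∈Δ =
    let z , z∈Tw , fz≈ = f-surj (s⊤∈G₂ a∈Δ)
    in Δ.down (¬¬a≤preimage a∈Δ z z∈Tw fz≈) (proj₂ z∈Tw)

corollary3p3p1 : ∀ {c ℓ₁ ℓ₂ p} (A : HeytingAlgebra c ℓ₁ ℓ₂)
    (∇ Δ : Pred (HeytingAlgebra.Carrier A) p) →
    HA.IsFilter A ∇ →
    (∀ {a} → HA.Dense A a → a Relation.Unary.∈ ∇) →
    HA.IsIdeal A Δ →
    OpenPairRep A ∇ Δ ⇔ω HA.ClosedIdeal A Δ
corollary3p3p1 A ∇ Δ ∇-filter dense⊆∇ Δ-ideal = record
  { to = RepresentationClosesIdeal.Δ-closed A ∇ Δ ∇-filter Δ-ideal dense⊆∇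
  ; from = ClosedIdealRepresentation.representation A ∇ Δ ∇-filter Δ-ideal dense⊆∇
  }
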